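{- Let $\varphi$ be a state formula of $\mathcal{L}_{\mathrm{HDMAS}}$ and $t$ a term. (C-mon) Let $C,C'\in\mathbb{N}$ with $C'>C$. (C-mon)$^+$: if all free occurrences of $t$ in $\varphi$ are positive and occur only in first position of strategic operators $\langle\langle\cdot,\cdot\rangle\rangle$, then $\models\varphi[C/t]\to\varphi[C'/t]$. (C-mon)$^-$: if all free occurrences of $t$ in $\varphi$ are negative and occur only in first position of strategic operators, then $\models\varphi[C'/t]\to\varphi[C/t]$. (N-mon) Let $N,N'\in\mathbb{N}$ with $N'<N$. (N-mon)$^+$: if all free occurrences of $t$ in $\varphi$ are positive and occur only in second position of strategic operators, then $\models\varphi[N/t]\to\varphi[N'/t]$. (N-mon)$^-$: if all free occurrences of $t$ in $\varphi$ are negative and occur only in second position of strategic operators, then $\models\varphi[N'/t]\to\varphi[N/t]$.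
   Context: HDMAS setting: countable agents $\mathit{Ag}$; actions $\mathit{Act}=\{act_1,\dots,act_n\}$, idle action $\varepsilon$, $\mathit{Act}^+=\mathit{Act}\cup\{\varepsilon\}$; action counters $x_1,\dots,x_n,x_\varepsilon$ with $\mu(act_i)=x_i$, $\mu(\varepsilon)=x_\varepsilon$. Guards are quantifier-free Presburger formulas over $x_1,\dots,x_n$. An action distribution is $\eta:X'\to\mathbb{N}$ with $X'\subseteq\{x_1,\dots,x_n,x_\varepsilon\}$; $H_m$ is the set of those whose values sum to $m$; $\eta_1\oplus\eta_2$ is the pointwise sum of two distributions with equal domain. An HDMAS is $\mathcal{M}=\langle\mathit{Ag},\mathit{Act}^+,S,d,\delta,\mathit{AP},\lambda\rangle$ with states $S$, available actions $d(s)\ni\varepsilon$, guards $\delta(s,s')$ over $\mu[d(s)]$ such that each distribution with domain $\mu[d(s)]$ satisfies $\delta(s,s')$ for exactly one $s'$, and labelling $\lambda:S\to\mathcal{P}(\mathit{AP})$; the (partial) transition function $\Delta(s,\eta)$ is the state $s'$ with $\eta\models\delta(s,s')$ (for distributions realised by action profiles of available actions). An abstract joint strategy for $C$ agents is a map $\rho_C$ assigning to each $s$ some $\rho_C(s)\in H_C$ with domain $\mu[d(s)]$. Its outcome plays against $N$ uncontrollable agents, $\mathit{out}(s,\rho_C,N)$, are the sequences $s_0s_1\dots$ with $s_0=s$ and, for each $i$, $s_{i+1}=\Delta(s_i,\rho_C(s_i)\oplus\eta_i)$ for some $\eta_i\in H_N$ with domain $\mu[d(s_i)]$. Logic $\mathcal{L}_{\mathrm{HDMAS}}$: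 agent counters $y_1,y_2$, parameters $z_1,z_2,\dots$, terms $T=\{y_1,y_2\}\cup\{z_i\}\cup\mathbb{N}$. Path formulas: $\mathsf{X}\varphi$, $\mathsf{G}\varphi$, $\psi\,\mathsf{U}\,\varphi$ ($\varphi,\psi$ state formulas). State formulas: $\top$, $p\in\mathit{AP}$, $\neg\varphi$, $\varphi\wedge\varphi$, $\varphi\vee\varphi$, $\langle\langle t_1,t_2\rangle\rangle\chi$ with $t_1\in T\setminus\{y_2\}$, $t_2\in T\setminus\{y_1\}$, $\chi$ a path formula, and $\forall y\varphi$, $\exists y\varphi$ ($y\in\{y_1,y_2\}$) provided all free occurrences of $y$ in $\varphi$ are positive (in the scope of an even number of negations); negative means in the scope of an odd number of negations. An assignment is $\theta:T\to\mathbb{N}$ with $\theta(k)=k$ for $k\in\mathbb{N}$. Semantics: $\mathcal{M},s,\theta\models p$ iff $p\in\lambda(s)$; Boolean connectives standard; $\mathcal{M},s,\theta\models\langle\langle t_1,t_2\rangle\rangle\chi$ iff there is an abstract joint strategy $\rho_C$ for $C=\theta(t_1)$ agents such that every play $w\in\mathit{out}(s,\rho_C,\theta(t_2))$ satisfies $\chi$, where $w$ satisfies $\mathsf{X}\varphi$ iff $w[1]$ satisfies $\varphi$, $\mathsf{G}\varphi$ iff every $w[i]$ does, $\psi\,\mathsf{U}\,\varphi$ iff some $w[i]$ satisfies $\varphi$ and all $w[j]$, $j<i$, satisfy $\psi$; $\forall y\varphi$ / $\exists y\varphi$ quantify over values $m\in\mathbb{N}$ of $y$. $\models\varphi$ means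 $\varphi$ is true at every state of every HDMAS under every assignment. $\varphi[k/t]$ denotes replacing all free occurrences of $t$ by $k$. -}

module Defs where

open import Data.Nat using (ℕ; zero; suc; _+_; _*_; _≤_; _<_; _≡ᵇ_; ∣_-_∣)
open import Data.Nat.Divisibility using (_∣_)
open import Data.Fin using (Fin)
import Data.Fin as F
open import Data.Bool using (Bool; true; false; if_then_else_)
open import Data.Product using (Σ; _×_; _,_)
open import Data.Sum using (_⊎_)
open import Data.Unit using (⊤)
open import Relation.Nullary using (¬_)
open import Relation.Binary.PropositionalEquality using (_≡_; _≢_)
open import Function.Bundles using (_↣_)

-- Quantifier-free Presburger formulas over the action counters x_1..x_n
-- (variable  pvar i  stands for x_{i+1}; x_ε is NOT available to guards)

data PTerm (n : ℕ) : Set where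
  pconst : ℕ → PTerm n
  pvar   : Fin n → PTerm n
  _p+_   : PTerm n → PTerm n → PTerm n
  _p*_   : ℕ → PTerm n → PTerm n

data PForm (n : ℕ) : Set where
  ptrue : PForm n
  _p≤_  : PTerm n → PTerm n → PForm n
  _p≡_  : PTerm n → PTerm n → PForm n
  pcong : ℕ → PTerm n → PTerm n → PForm n
  p¬    : PForm n → PForm n
  _p∧_  : PForm n → PForm n → PForm n
  _p∨_  : PForm n → PForm n → PForm n

evalP : ∀ {n} → (Fin n → ℕ) → PTerm n → ℕ
evalP x (pconst k) = k
evalP x (pvar i)   = x i
evalP x (a p+ b)   = evalP x a + evalP x b
evalP x (k p* a)   = k * evalP x a

⟦_⟧P : ∀ {n} → PForm n → (Fin n → ℕ) → Set
⟦ ptrue ⟧P x      = ⊤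
⟦ a p≤ b ⟧P x     = evalP x a ≤ evalP x b
⟦ a p≡ b ⟧P x     = evalP x a ≡ evalP x b
⟦ pcong m a b ⟧P x = m ∣ ∣ evalP x a - evalP x b ∣
⟦ p¬ f ⟧P x       = ¬ ⟦ f ⟧P x
⟦ f p∧ g ⟧P x     = ⟦ f ⟧P x × ⟦ g ⟧P x
⟦ f p∨ g ⟧P x     = ⟦ f ⟧P x ⊎ ⟦ g ⟧P x

TUses : ∀ {n} → (Fin n → Set) → PTerm n → Set
TUses V (pconst k) = ⊤
TUses V (pvar i)   = V i
TUses V (a p+ b)   = TUses V a × TUses V b
TUses V (k p* a)   = TUses V a

Uses : ∀ {n} → (Fin n → Set) → PForm n → Set
Uses V ptrue         = ⊤
Uses V (a p≤ b)      = TUses V a × TUses V b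
Uses V (a p≡ b)      = TUses V a × TUses V b
Uses V (pcong m a b) = TUses V a × TUses V b
Uses V (p¬ f)        = Uses V f
Uses V (f p∧ g)      = Uses V f × Uses V g
Uses V (f p∨ g)      = Uses V f × Uses V g

data Act⁺ (n : ℕ) : Set where
  act : Fin n → Act⁺ n
  ε   : Act⁺ n

sumFin : ∀ {n} → (Fin n → ℕ) → ℕ
sumFin {zero}  f = 0
sumFin {suc n} f = f F.zero + sumFin (λ i → f (F.suc i))

total : ∀ {n} → (Act⁺ n → ℕ) → ℕ
total η = η ε + sumFin (λ i → η (act i))

-- an action distribution with domain μ[D] is represented as a map on all
-- counters that vanishes outside D
Respects : ∀ {n} → (Act⁺ n → Bool) → (Act⁺ n → ℕ) → Set
Respects D η = ∀ a → D a ≡ false → η a ≡ 0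

record Distr {n : ℕ} (D : Act⁺ n → Bool) (m : ℕ) : Set where
  field
    vec  : Act⁺ n → ℕ
    dom  : Respects D vec
    sums : total vec ≡ m
open Distr public

_⊕_ : ∀ {n} → (Act⁺ n → ℕ) → (Act⁺ n → ℕ) → (Act⁺ n → ℕ)
(η₁ ⊕ η₂) a = η₁ a + η₂ a

counters : ∀ {n} → (Act⁺ n → ℕ) → Fin n → ℕ
counters η i = η (act i)

record HDMAS (AP : Set) : Set₁ where
  field
    Ag           : Set
    Ag-countable : Ag ↣ ℕ
    n            : ℕ
    S            : Set
    d            : S → Act⁺ n → Bool
    ε-avail      : ∀ s → d s ε ≡ true
    δ            : S → S → PForm n
    δ-over-d     : ∀ s s' → Uses (λ i → d s (act i) ≡ true) (δ s s')
    δ-exactly-one : ∀ s (η : Act⁺ n → ℕ) → Respects (d s) η →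
                    Σ S (λ s' → ⟦ δ s s' ⟧P (counters η)
                         × (∀ s'' → ⟦ δ s s'' ⟧P (counters η) → s'' ≡ s'))
    lab          : S → AP → Set

module _ {AP : Set} (M : HDMAS AP) where
  open HDMAS M

  -- s' = Δ(s, η)  (well defined by δ-exactly-one)
  Step : S → (Act⁺ n → ℕ) → S → Set
  Step s η s' = ⟦ δ s s' ⟧P (counters η)

  Strategy : ℕ → Set
  Strategy C = (s : S) → Distr (d s) C

  Out : S → {C : ℕ} → Strategy C → ℕ → (ℕ → S) → Set
  Out s ρ N w = (w 0 ≡ s) ×
    (∀ i → Σ (Distr (d (w i)) N) λ η →
             Step (w i) (vec (ρ (w i)) ⊕ vec η) (w (suc i)))

data Var : Set where
  v₁ v₂ : Var

data Term : Set where
  var : Var → Term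
  par : ℕ → Term
  num : ℕ → Term

mutual
  data StateF (AP : Set) : Set where
    ⊤f    : StateF AP
    atom  : AP → StateF AP
    ¬f    : StateF AP → StateF AP
    _∧f_  : StateF AP → StateF AP → StateF AP
    _∨f_  : StateF AP → StateF AP → StateF AP
    ⟪_,_⟫_ : Term → Term → PathF AP → StateF AP
    ∀f    : Var → StateF AP → StateF AP
    ∃f    : Var → StateF AP → StateF AP

  data PathF (AP : Set) : Set where
    Xf  : StateF AP → PathF AP
    Gf  : StateF AP → PathF AP
    _Uf_ : StateF AP → StateF AP → PathF AP

_==V_ : Var → Var → Bool
v₁ ==V v₁ = true
v₂ ==V v₂ = true
_  ==V _  = false

_==T_ : Term → Term → Bool
var x ==T var y = x ==V y
par i ==T par j = i ≡ᵇ j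
num i ==T num j = i ≡ᵇ j
_     ==T _     = false

substT : ℕ → Term → Term → Term
substT k t u = if u ==T t then num k else u

mutual
  _[_/_] : ∀ {AP} → StateF AP → ℕ → Term → StateF AP
  ⊤f [ k / t ]           = ⊤f
  atom p [ k / t ]       = atom p
  ¬f φ [ k / t ]         = ¬f (φ [ k / t ])
  (φ ∧f ψ) [ k / t ]     = (φ [ k / t ]) ∧f (ψ [ k / t ])
  (φ ∨f ψ) [ k / t ]     = (φ [ k / t ]) ∨f (ψ [ k / t ])
  (⟪ t₁ , t₂ ⟫ χ) [ k / t ] = ⟪ substT k t t₁ , substT k t t₂ ⟫ (χ [ k / t ]ₚ)
  ∀f y φ [ k / t ]       = if var y ==T t then ∀f y φ else ∀f y (φ [ k / t ])
  ∃f y φ [ k / t ]       = if var y ==T t then ∃f y φ else ∃f y (φ [ k / t ])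

  _[_/_]ₚ : ∀ {AP} → PathF AP → ℕ → Term → PathF AP
  Xf φ [ k / t ]ₚ     = Xf (φ [ k / t ])
  Gf φ [ k / t ]ₚ     = Gf (φ [ k / t ])
  (ψ Uf φ) [ k / t ]ₚ = (ψ [ k / t ]) Uf (φ [ k / t ])

data Pol : Set where
  pos neg : Pol

flip : Pol → Pol
flip pos = neg
flip neg = pos

data Slot : Set where
  first second : Slot

-- AllFree P t c φ : every free occurrence of t in φ, whose polarity
-- (relative to the current polarity c) is c' and which sits in slot sl,
-- satisfies P c' sl.
mutual
  AllFree : ∀ {AP} → (Pol → Slot → Set) → Term → Pol → StateF AP → Set
  AllFree P t c ⊤f             = ⊤
  AllFree P t c (atom p)       = ⊤
  AllFree P t c (¬f φ)         = AllFree P t (flip c) φ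
  AllFree P t c (φ ∧f ψ)       = AllFree P t c φ × AllFree P t c ψ
  AllFree P t c (φ ∨f ψ)       = AllFree P t c φ × AllFree P t c ψ
  AllFree P t c (⟪ t₁ , t₂ ⟫ χ) =
    (t₁ ≡ t → P c first) × (t₂ ≡ t → P c second) × AllFreeₚ P t c χ
  AllFree P t c (∀f y φ)       = if var y ==T t then ⊤ else AllFree P t c φ
  AllFree P t c (∃f y φ)       = if var y ==T t then ⊤ else AllFree P t c φ

  AllFreeₚ : ∀ {AP} → (Pol → Slot → Set) → Term → Pol → PathF AP → Set
  AllFreeₚ P t c (Xf φ)   = AllFree P t c φ
  AllFreeₚ P t c (Gf φ)   = AllFree P t c φ
  AllFreeₚ P t c (ψ Uf φ) = AllFree P t c ψ × AllFree P t c φ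

AllPol : ∀ {AP} → Pol → Term → StateF AP → Set
AllPol p t φ = AllFree (λ c _ → c ≡ p) t pos φ

AllPolIn : ∀ {AP} → Pol → Slot → Term → StateF AP → Set
AllPolIn p sl t φ = AllFree (λ c sl' → (c ≡ p) × (sl' ≡ sl)) t pos φ

mutual
  WF : ∀ {AP} → StateF AP → Set
  WF ⊤f               = ⊤
  WF (atom p)         = ⊤
  WF (¬f φ)           = WF φ
  WF (φ ∧f ψ)         = WF φ × WF ψ
  WF (φ ∨f ψ)         = WF φ × WF ψ
  WF (⟪ t₁ , t₂ ⟫ χ)  = (t₁ ≢ var v₂) × (t₂ ≢ var v₁) × WFₚ χ
  WF (∀f y φ)         = AllPol pos (var y) φ × WF φ
  WF (∃f y φ)         = AllPol pos (var y) φ × WF φ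

  WFₚ : ∀ {AP} → PathF AP → Set
  WFₚ (Xf φ)   = WF φ
  WFₚ (Gf φ)   = WF φ
  WFₚ (ψ Uf φ) = WF ψ × WF φ

record Assignment : Set where
  field
    ay₁ ay₂ : ℕ
    az      : ℕ → ℕ
open Assignment public

⟦_⟧T : Term → Assignment → ℕ
⟦ var v₁ ⟧T θ = ay₁ θ
⟦ var v₂ ⟧T θ = ay₂ θ
⟦ par i ⟧T θ  = az θ i
⟦ num k ⟧T θ  = k

_[_↦_] : Assignment → Var → ℕ → Assignment
θ [ v₁ ↦ m ] = record θ { ay₁ = m }
θ [ v₂ ↦ m ] = record θ { ay₂ = m }

module _ {AP : Set} (M : HDMAS AP) where
  open HDMAS M

  mutual
    Sat : S → Assignment → StateF AP → Set
    Sat s θ ⊤f        = ⊤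
    Sat s θ (atom p)  = lab s p
    Sat s θ (¬f φ)    = ¬ Sat s θ φ
    Sat s θ (φ ∧f ψ)  = Sat s θ φ × Sat s θ ψ
    Sat s θ (φ ∨f ψ)  = Sat s θ φ ⊎ Sat s θ ψ
    Sat s θ (⟪ t₁ , t₂ ⟫ χ) =
      Σ (Strategy M (⟦ t₁ ⟧T θ)) λ ρ →
        ∀ (w : ℕ → S) → Out M s ρ (⟦ t₂ ⟧T θ) w → SatP w θ χ
    Sat s θ (∀f y φ)  = (m : ℕ) → Sat s (θ [ y ↦ m ]) φ
    Sat s θ (∃f y φ)  = Σ ℕ λ m → Sat s (θ [ y ↦ m ]) φ

    SatP : (ℕ → S) → Assignment → PathF AP → Set
    SatP w θ (Xf φ)   = Sat (w 1) θ φ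
    SatP w θ (Gf φ)   = ∀ i → Sat (w i) θ φ
    SatP w θ (ψ Uf φ) = Σ ℕ λ i → Sat (w i) θ φ × (∀ j → j < i → Sat (w j) θ ψ)

Valid⇒ : ∀ {AP : Set} → StateF AP → StateF AP → Set₁
Valid⇒ {AP} φ ψ = ∀ (M : HDMAS AP) (s : HDMAS.S M) (θ : Assignment) →
                  Sat M s θ φ → Sat M s θ ψ

module Submission where

-- A coalition of C agents can simulate a coalition of C' ≥ C agents
-- by letting the C' - C extra agents idle (the idle action ε is available
-- everywhere), so the outcomes of the padded strategy are outcomes of the
-- original one.  Dually, N' ≤ N opponents can only produce plays that N
-- opponents could produce as well, by letting N - N' of them idle.  Hence
-- ⟪C,N⟫χ implies ⟪C',N'⟫χ whenever C ≤ C' and N' ≤ N.  Structural induction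
-- over formulas lifts this to arbitrary φ: an occurrence of t in positive
-- position transfers truth from φ[a/t] to φ[b/t], negation swaps the
-- direction, and in negative context t occurs at no strategic operator.

open import Defs
open import Data.Nat using (ℕ; _+_; _≤_; _<_)
open import Data.Nat.Properties
  using (≡ᵇ⇒≡; m≤n⇒∃[o]m+o≡n; <⇒≤; +-commutativeSemigroup)
open import Algebra.Properties.CommutativeSemigroup +-commutativeSemigroup
  using (xy∙z≈xz∙y)
open import Data.Bool using (Bool; true; false; T)
open import Data.Product using (Σ; _×_; _,_; proj₁; proj₂)
open import Data.Sum using (inj₁; inj₂)
open import Function using (_∘_)
open import Relation.Nullary using (contradiction)
open import Relation.Binary.PropositionalEquality
  using (_≡_; _≢_; refl; sym; trans; cong; subst; module ≡-Reasoning)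

==V-sound : ∀ x y → (x ==V y) ≡ true → x ≡ y
==V-sound v₁ v₁ _ = refl
==V-sound v₂ v₂ _ = refl

==T-sound : ∀ u t → (u ==T t) ≡ true → u ≡ t
==T-sound (var x) (var y) e = cong var (==V-sound x y e)
==T-sound (par i) (par j) e = cong par (≡ᵇ⇒≡ i j (subst T (sym e) _))
==T-sound (num i) (num j) e = cong num (≡ᵇ⇒≡ i j (subst T (sym e) _))

substT-fresh : ∀ k t u → u ≢ t → substT k t u ≡ u
substT-fresh k t u u≢t with u ==T t in eq
... | true  = contradiction (==T-sound u t eq) u≢t
... | false = refl

flip-flip : ∀ p → flip (flip p) ≡ p
flip-flip pos = refl
flip-flip neg = refl

flip≢ : ∀ p → flip p ≢ p
flip≢ pos ()
flip≢ neg ()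

first≢second : first ≢ second
first≢second ()

addIdlers : ∀ {n} → (Act⁺ n → ℕ) → ℕ → Act⁺ n → ℕ
addIdlers η k (act i) = η (act i)
addIdlers η k ε       = η ε + k

padIdle : ∀ {n} {D : Act⁺ n → Bool} {m} → D ε ≡ true →
          Distr D m → (k : ℕ) → Distr D (m + k)
padIdle {D = D} {m} ε∈D η k = record
  { vec = addIdlers (vec η) k ; dom = respects ; sums = total-padded }
  where
    respects : Respects D (addIdlers (vec η) k)
    respects (act i) i∉D = dom η (act i) i∉D
    respects ε       ε∉D = contradiction (trans (sym ε∈D) ε∉D) λ ()

    open ≡-Reasoning
    total-padded : total (addIdlers (vec η) k) ≡ m + k
    total-padded = begin
      (vec η ε + k) + sumFin (λ i → vec η (act i)) ≡⟨ xy∙z≈xz∙y (vec η ε) k _ ⟩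
      total (vec η) + k                             ≡⟨ cong (_+ k) (sums η) ⟩
      m + k                                         ∎

module _ {AP : Set} (M : HDMAS AP) where
  open HDMAS M

  Enforces : S → ℕ → ℕ → ((ℕ → S) → Set) → Set
  Enforces s C N P = Σ (Strategy M C) λ ρ → ∀ w → Out M s ρ N w → P w

  Stronger : ℕ → ℕ → ℕ → ℕ → Set
  Stronger C N C' N' = (ρ : Strategy M C) → Σ (Strategy M C') λ ρ' →
    ∀ s w → Out M s ρ' N' w → Out M s ρ N w

  stronger-refl : ∀ {C N} → Stronger C N C N
  stronger-refl ρ = ρ , λ s w out → out

  -- More coalition members: the additional agents idle.
  stronger-coalition : ∀ {C C' N} → C ≤ C' → Stronger C N C' N
  stronger-coalition C≤C' ρ with m≤n⇒∃[o]m+o≡n C≤C'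
  ... | k , refl = (λ s → padIdle (ε-avail s) (ρ s) k) , λ s w out → out

  -- Fewer opponents: their moves are those of N opponents of whom N - N' idle.
  stronger-opponents : ∀ {C N N'} → N' ≤ N → Stronger C N C N'
  stronger-opponents N'≤N ρ with m≤n⇒∃[o]m+o≡n N'≤N
  ... | k , refl = ρ , λ s w (start , steps) → start , λ i →
    let (η , step) = steps i in padIdle (ε-avail (w i)) η k , step

  enforces-mono : ∀ {C N C' N'} → Stronger C N C' N' → ∀ s {P Q : (ℕ → S) → Set} →
    (∀ w → P w → Q w) → Enforces s C N P → Enforces s C' N' Q
  enforces-mono stronger s P⇒Q (ρ , wins) =
    let (ρ' , sim) = stronger ρ in ρ' , λ w out → P⇒Q w (wins w (sim s w out))

  OnlyIn : Slot → Term → Term → Term → Set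
  OnlyIn sl t t₁ t₂ = (t₁ ≡ t → first ≡ sl) × (t₂ ≡ t → second ≡ sl)

  module Transfer (t : Term) (sl : Slot) (a b : ℕ)
    (strengthen : ∀ θ t₁ t₂ → OnlyIn sl t t₁ t₂ →
       Stronger (⟦ substT a t t₁ ⟧T θ) (⟦ substT a t t₂ ⟧T θ)
                (⟦ substT b t t₁ ⟧T θ) (⟦ substT b t t₂ ⟧T θ))
    (p : Pol) where

    Occ : Pol → Slot → Set
    Occ c sl' = (c ≡ p) × (sl' ≡ sl)

    unaffected : ∀ θ t₁ t₂ → t₁ ≢ t → t₂ ≢ t →
      Stronger (⟦ substT b t t₁ ⟧T θ) (⟦ substT b t t₂ ⟧T θ)
               (⟦ substT a t t₁ ⟧T θ) (⟦ substT a t t₂ ⟧T θ)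
    unaffected θ t₁ t₂ t₁≢t t₂≢t
      rewrite substT-fresh a t t₁ t₁≢t | substT-fresh b t t₁ t₁≢t
            | substT-fresh a t t₂ t₂≢t | substT-fresh b t t₂ t₂≢t
      = stronger-refl

    mutual
      preserve : ∀ (φ : StateF AP) → AllFree Occ t p φ →
        ∀ s θ → Sat M s θ (φ [ a / t ]) → Sat M s θ (φ [ b / t ])
      preserve ⊤f       h s θ x = x
      preserve (atom q) h s θ x = x
      preserve (¬f φ)   h s θ x y = x (reflect φ h s θ y)
      preserve (φ ∧f ψ) (hφ , hψ) s θ (x , y) = preserve φ hφ s θ x , preserve ψ hψ s θ y
      preserve (φ ∨f ψ) (hφ , hψ) s θ (inj₁ x) = inj₁ (preserve φ hφ s θ x)
      preserve (φ ∨f ψ) (hφ , hψ) s θ (inj₂ y) = inj₂ (preserve ψ hψ s θ y)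
      preserve (⟪ t₁ , t₂ ⟫ χ) (h₁ , h₂ , hχ) s θ =
        enforces-mono (strengthen θ t₁ t₂ (proj₂ ∘ h₁ , proj₂ ∘ h₂)) s
          (λ w → preserveₚ χ hχ w θ)
      preserve (∀f y φ) h s θ x with var y ==T t
      ... | true  = x
      ... | false = λ m → preserve φ h s (θ [ y ↦ m ]) (x m)
      preserve (∃f y φ) h s θ x with var y ==T t
      ... | true  = x
      ... | false = let (m , xm) = x in m , preserve φ h s (θ [ y ↦ m ]) xm

      preserveₚ : ∀ (χ : PathF AP) → AllFreeₚ Occ t p χ →
        ∀ w θ → SatP M w θ (χ [ a / t ]ₚ) → SatP M w θ (χ [ b / t ]ₚ)
      preserveₚ (Xf φ)   h w θ x   = preserve φ h (w 1) θ x
      preserveₚ (Gf φ)   h w θ x i = preserve φ h (w i) θ (x i)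
      preserveₚ (ψ Uf φ) (hψ , hφ) w θ (i , x , y) =
        i , preserve φ hφ (w i) θ x , λ j j<i → preserve ψ hψ (w j) θ (y j j<i)

      reflect : ∀ (φ : StateF AP) → AllFree Occ t (flip p) φ →
        ∀ s θ → Sat M s θ (φ [ b / t ]) → Sat M s θ (φ [ a / t ])
      reflect ⊤f       h s θ x = x
      reflect (atom q) h s θ x = x
      reflect (¬f φ)   h s θ x y =
        x (preserve φ (subst (λ c → AllFree Occ t c φ) (flip-flip p) h) s θ y)
      reflect (φ ∧f ψ) (hφ , hψ) s θ (x , y) = reflect φ hφ s θ x , reflect ψ hψ s θ y
      reflect (φ ∨f ψ) (hφ , hψ) s θ (inj₁ x) = inj₁ (reflect φ hφ s θ x)
      reflect (φ ∨f ψ) (hφ , hψ) s θ (inj₂ y) = inj₂ (reflect ψ hψ s θ y)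
      reflect (⟪ t₁ , t₂ ⟫ χ) (h₁ , h₂ , hχ) s θ =
        enforces-mono (unaffected θ t₁ t₂ (wrong-polarity h₁) (wrong-polarity h₂)) s
          (λ w → reflectₚ χ hχ w θ)
        where
          wrong-polarity : ∀ {u sl'} → (u ≡ t → Occ (flip p) sl') → u ≢ t
          wrong-polarity occ u≡t = flip≢ p (proj₁ (occ u≡t))
      reflect (∀f y φ) h s θ x with var y ==T t
      ... | true  = x
      ... | false = λ m → reflect φ h s (θ [ y ↦ m ]) (x m)
      reflect (∃f y φ) h s θ x with var y ==T t
      ... | true  = x
      ... | false = let (m , xm) = x in m , reflect φ h s (θ [ y ↦ m ]) xm

      reflectₚ : ∀ (χ : PathF AP) → AllFreeₚ Occ t (flip p) χ →
        ∀ w θ → SatP M w θ (χ [ b / t ]ₚ) → SatP M w θ (χ [ a / t ]ₚ)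
      reflectₚ (Xf φ)   h w θ x   = reflect φ h (w 1) θ x
      reflectₚ (Gf φ)   h w θ x i = reflect φ h (w i) θ (x i)
      reflectₚ (ψ Uf φ) (hψ , hφ) w θ (i , x , y) =
        i , reflect φ hφ (w i) θ x , λ j j<i → reflect ψ hψ (w j) θ (y j j<i)

  strengthen-first : ∀ t {C C'} → C ≤ C' → ∀ θ t₁ t₂ → OnlyIn first t t₁ t₂ →
    Stronger (⟦ substT C t t₁ ⟧T θ) (⟦ substT C t t₂ ⟧T θ)
             (⟦ substT C' t t₁ ⟧T θ) (⟦ substT C' t t₂ ⟧T θ)
  strengthen-first t {C} {C'} C≤C' θ t₁ t₂ (_ , t₂-first)
    rewrite substT-fresh C t t₂ (λ eq → first≢second (sym (t₂-first eq)))
          | substT-fresh C' t t₂ (λ eq → first≢second (sym (t₂-first eq)))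
    with t₁ ==T t
  ... | true  = stronger-coalition C≤C'
  ... | false = stronger-refl

  strengthen-second : ∀ t {N N'} → N' ≤ N → ∀ θ t₁ t₂ → OnlyIn second t t₁ t₂ →
    Stronger (⟦ substT N t t₁ ⟧T θ) (⟦ substT N t t₂ ⟧T θ)
             (⟦ substT N' t t₁ ⟧T θ) (⟦ substT N' t t₂ ⟧T θ)
  strengthen-second t {N} {N'} N'≤N θ t₁ t₂ (t₁-second , _)
    rewrite substT-fresh N t t₁ (λ eq → first≢second (t₁-second eq))
          | substT-fresh N' t t₁ (λ eq → first≢second (t₁-second eq))
    with t₂ ==T t
  ... | true  = stronger-opponents N'≤N
  ... | false = stronger-refl

-- (C-mon)± and (N-mon)±: instantiate the transfer theorem with polarity pos
-- for the positive variants and with polarity neg (read backwards at the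
-- top-level positive context) for the negative ones.
lemma5 : {AP : Set} (φ : StateF AP) (t : Term) → WF φ →
    ((C C' : ℕ) → C < C' →
        (AllPolIn pos first t φ → Valid⇒ (φ [ C / t ]) (φ [ C' / t ]))
      × (AllPolIn neg first t φ → Valid⇒ (φ [ C' / t ]) (φ [ C / t ])))
    × ((N N' : ℕ) → N' < N →
        (AllPolIn pos second t φ → Valid⇒ (φ [ N / t ]) (φ [ N' / t ]))
      × (AllPolIn neg second t φ → Valid⇒ (φ [ N' / t ]) (φ [ N / t ])))
lemma5 φ t _ =
  (λ C C' C<C' →
    (λ h M → CMon.preserve M C<C' pos φ h) ,
    (λ h M → CMon.reflect  M C<C' neg φ h)) ,
  (λ N N' N'<N →
    (λ h M → NMon.preserve M N'<N pos φ h) ,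
    (λ h M → NMon.reflect  M N'<N neg φ h))
  where
    module CMon {AP} (M : HDMAS AP) {C C'} (C<C' : C < C') =
      Transfer M t first C C' (strengthen-first M t (<⇒≤ C<C'))
    module NMon {AP} (M : HDMAS AP) {N N'} (N'<N : N' < N) =
      Transfer M t second N N' (strengthen-second M t (<⇒≤ N'<N))
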